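{- Consider any instance of the Online Budgeted Repeated Matching (OBRM) problem (defined in the context) in which every edge weight satisfies $w(i,j)\le \tfrac12 C_i$ for every server $i$ and job $j$. Let $A(T)=\bigcup_{t\le T}M(t)$ be the set of edges selected by the algorithm ONLINEGREEDY (defined in the context), and let $\mathrm{OPT}$ be the maximum total weight of a feasible set of edges for the instance. Then $W(A(T))\ge \tfrac13\,\mathrm{OPT}$, i.e. ONLINEGREEDY is $3$-competitive.
   Context: OBRM problem: there is a set $I=\{1,\dots,n\}$ of servers, server $i$ having capacity $C_i>0$. At each time step $t\in\{1,\dots,T\}$ a set of jobs $J(t)$ and a set $E(t)$ of edges between servers $I$ and jobs $J(t)$ are revealed, forming the bipartite graph $G(t)=(I\cup J(t),E(t))$; each edge $e=(i,j)$ has a nonnegative weight $w(e)=w(i,j)$ (the resources of server $i$ consumed if job $j$ is assigned to $i$; a job may have different weights on different servers). Let $E=\bigcup_{t\le T}E(t)$. For a set of edges $F$, $W(F)=\sum_{e\in F}w(e)$ and $F(t)=F\cap E(t)$. A set $F\subseteq E$ is feasible if (i) $F(t)$ is a matching for every $t$ (each server and each job is incident to at most one edge of $F(t)$), and (ii) for each server $i$ the total weight of edges of $F$ incident to $i$ is at most $C_i$. An online algorithm must choose $M(t)\subseteq E(t)$ irrevocably at time $t$ knowing only $G(1),\dots,G(t)$; the goal is to maximize $W(\bigcup_t M(t))$ subject to feasibility. An algorithm is $\gamma$-competitive if on every instance its total weight is at least $1/\gamma$ times the optimal (offline) feasible weight. Subroutine GREEDY$(G,S)$: given a weighted bipartite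 graph $G$ between servers and jobs and a set $S$ of servers, start with $M=\emptyset$ and scan the edges of $G$ in non-increasing order of weight; add edge $(i,j)$ to $M$ if $i\in S$ and $M\cup\{(i,j)\}$ is still a matching. Return $M$. ONLINEGREEDY: initially $S=I$ (the set of active servers) and $A_i(0)=\emptyset$ for all $i$. For $t=1,\dots,T$: set $M(t)=$GREEDY$(G(t),S)$ and $A(t)=A(t-1)\cup M(t)$; for each $(i,j)\in M(t)$, letting $A_i(t)$ be the edges of $A(t)$ incident to server $i$, if $W(A_i(t))>\tfrac12 C_i$ then remove $i$ from $S$.
   Formalization: The edge weights $w(i,j)$ and the server capacities $C_i$ are rational. -}

module Defs where

open import Data.Nat using (ℕ; zero; suc)
open import Data.Fin using (Fin; zero; suc; _≟_)
open import Data.Bool using (Bool; true; false; _∧_; _∨_; not; if_then_else_)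
open import Data.List using (List; []; _∷_; allFin)
open import Data.Bool.ListAction using (any)
open import Data.List.Relation.Unary.AllPairs using (AllPairs)
open import Data.List.Relation.Binary.Permutation.Propositional using (_↭_)
open import Data.Product using (_×_)
open import Data.Unit using (⊤)
open import Data.Rational using (ℚ; 0ℚ; ½; _+_; _*_; _≤_; _<_)
open import Data.Rational.Properties using (_<?_)
open import Relation.Nullary using (¬_)
open import Relation.Nullary.Decidable using (⌊_⌋)
open import Relation.Binary.PropositionalEquality using (_≡_; _≢_)

-- One time step t: the bipartite graph G(t) between the servers Fin n and the
-- jobs J(t) = Fin m.
record Round (n : ℕ) : Set where
  field
    m   : ℕ
    k   : ℕ
    srv : Fin k → Fin n
    job : Fin k → Fin m
    w   : Fin k → ℚ
open Round public

WellFormedRound : ∀ {n} → Round n → Set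
WellFormedRound r =
  (∀ e → 0ℚ ≤ w r e) ×
  (∀ e e' → srv r e ≡ srv r e' → job r e ≡ job r e' → e ≡ e')

WellFormed : ∀ {n} → List (Round n) → Set
WellFormed []       = ⊤
WellFormed (r ∷ rs) = WellFormedRound r × WellFormed rs

HalfCap : ∀ {n} → (Fin n → ℚ) → List (Round n) → Set
HalfCap C []       = ⊤
HalfCap C (r ∷ rs) = (∀ e → w r e ≤ ½ * C (srv r e)) × HalfCap C rs

-- A set of edges F ⊆ E: for each round, the characteristic function of F(t).
data Sel {n : ℕ} : List (Round n) → Set where
  []  : Sel []
  _∷_ : ∀ {r rs} → (Fin (k r) → Bool) → Sel rs → Sel (r ∷ rs)

sumFin : (k : ℕ) → (Fin k → ℚ) → ℚ
sumFin zero    f = 0ℚ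
sumFin (suc k) f = f zero + sumFin k (λ x → f (suc x))

roundWeight : ∀ {n} (r : Round n) → (Fin (k r) → Bool) → ℚ
roundWeight r s = sumFin (k r) (λ e → if s e then w r e else 0ℚ)

roundLoad : ∀ {n} (r : Round n) → (Fin (k r) → Bool) → Fin n → ℚ
roundLoad r s i =
  sumFin (k r) (λ e → if s e ∧ ⌊ srv r e ≟ i ⌋ then w r e else 0ℚ)

weight : ∀ {n} {rs : List (Round n)} → Sel rs → ℚ
weight []              = 0ℚ
weight (_∷_ {r} s ss)  = roundWeight r s + weight ss

load : ∀ {n} {rs : List (Round n)} → Sel rs → Fin n → ℚ
load []              i = 0ℚ
load (_∷_ {r} s ss)  i = roundLoad r s i + load ss i

IsMatching : ∀ {n} (r : Round n) → (Fin (k r) → Bool) → Set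
IsMatching r s = ∀ e e' → s e ≡ true → s e' ≡ true → e ≢ e' →
                 (srv r e ≢ srv r e') × (job r e ≢ job r e')

AllMatching : ∀ {n} {rs : List (Round n)} → Sel rs → Set
AllMatching []             = ⊤
AllMatching (_∷_ {r} s ss) = IsMatching r s × AllMatching ss

Feasible : ∀ {n} (C : Fin n → ℚ) {rs : List (Round n)} → Sel rs → Set
Feasible C F = AllMatching F × (∀ i → load F i ≤ C i)

-- A scan order for a round: a list of its edges (each exactly once), i.e. a
-- permutation of all edge indices, in non-increasing order of weight.
-- (Ties may be broken arbitrarily.)
data Orders {n : ℕ} : List (Round n) → Set where
  []  : Orders []
  _∷_ : ∀ {r rs} → List (Fin (k r)) → Orders rs → Orders (r ∷ rs)

ValidOrder : ∀ {n} (r : Round n) → List (Fin (k r)) → Set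
ValidOrder r o = (o ↭ allFin (k r)) × AllPairs (λ a b → w r b ≤ w r a) o

ValidOrders : ∀ {n} {rs : List (Round n)} → Orders rs → Set
ValidOrders []             = ⊤
ValidOrders (_∷_ {r} o os) = ValidOrder r o × ValidOrders os

conflict : ∀ {n} (r : Round n) → Fin (k r) → Fin (k r) → Bool
conflict r e e' = ⌊ srv r e ≟ srv r e' ⌋ ∨ ⌊ job r e ≟ job r e' ⌋

greedyScan : ∀ {n} (r : Round n) → (Fin n → Bool) →
             List (Fin (k r)) → List (Fin (k r)) → List (Fin (k r))
greedyScan r S ch []       = ch
greedyScan r S ch (e ∷ es) =
  if S (srv r e) ∧ not (any (conflict r e) ch)
  then greedyScan r S (e ∷ ch) es
  else greedyScan r S ch es

greedy : ∀ {n} (r : Round n) → (Fin n → Bool) → List (Fin (k r)) →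
         Fin (k r) → Bool
greedy r S o e = any (λ e' → ⌊ e ≟ e' ⌋) (greedyScan r S [] o)

matched : ∀ {n} (r : Round n) → (Fin (k r) → Bool) → Fin n → Bool
matched r M i = any (λ e → M e ∧ ⌊ srv r e ≟ i ⌋) (allFin (k r))

-- ONLINEGREEDY
-- State: S = active servers, L i = W(A_i(t-1)).
runOG : ∀ {n} (C : Fin n → ℚ) → (Fin n → Bool) → (Fin n → ℚ) →
        {rs : List (Round n)} → Orders rs → Sel rs
runOG C S L []             = []
runOG C S L (_∷_ {r} o os) = M ∷ runOG C S' L' os
  where
    M : Fin (k r) → Bool
    M = greedy r S o
    L' : _ → ℚ
    L' i = L i + roundLoad r M i
    S' : _ → Bool
    S' i = S i ∧ not (matched r M i ∧ ⌊ ½ * C i <? L' i ⌋)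

onlineGreedy : ∀ {n} (C : Fin n → ℚ) {rs : List (Round n)} → Orders rs → Sel rs
onlineGreedy C os = runOG C (λ _ → true) (λ _ → 0ℚ) os

module Submission where

-- Charge each edge e of F(t) either to its server or to its job. If e's server is active,
-- GREEDY chose an edge at least as heavy as e sharing its server or its job. Edges with such a
-- partner at their server (or at an inactive server) are charged to the server, the others to
-- their job; since F(t) is a matching, job charges in round t are at most W(M(t)). While
-- server i is active its charge per round is at most the weight GREEDY puts on i; if i is ever
-- deactivated then W(A_i) > C_i/2, so its whole charge is at most W(F_i) <= C_i < 2 W(A_i).
-- Hence W(F) <= 2 W(A) + W(A).

open import Defs
open import Algebra.Bundles using (CommutativeMonoid)
open import Data.Nat using (ℕ; zero; suc)
open import Data.Fin using (Fin; zero; suc; _≟_)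
open import Data.Fin.Properties using (any?; suc-injective)
open import Data.Bool using (Bool; true; false; T; _∧_; _∨_; not; if_then_else_)
open import Data.Bool.Properties using (T-≡; T-∨; ¬-not; ∧-conicalʳ) renaming (_≟_ to _≟ᵇ_)
open import Data.Bool.ListAction using (any)
open import Data.List using (List; []; _∷_)
open import Data.List.Relation.Unary.All as All using (All; _∷_)
open import Data.List.Relation.Unary.Any as Any using (here; there)
open import Data.List.Relation.Unary.Any.Properties using (any⁺; any⁻)
open import Data.List.Relation.Unary.AllPairs using (AllPairs; _∷_)
open import Data.List.Membership.Propositional using (_∈_; find)
open import Data.List.Membership.Propositional.Properties using (∈-allFin)
open import Data.List.Relation.Binary.Permutation.Propositional using (↭-sym)
open import Data.List.Relation.Binary.Permutation.Propositional.Properties using (∈-resp-↭)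
open import Data.Product using (_×_; _,_; ∃; proj₁; proj₂)
open import Data.Sum using (_⊎_; inj₁; inj₂)
open import Function using (_∘_; Equivalence)
open import Relation.Nullary using (¬_; yes; no; Dec; contradiction)
open import Relation.Nullary.Decidable using (⌊_⌋; _×-dec_; isYes≗does; dec-true; fromWitness; toWitness)
open import Relation.Unary using (Decidable)
open import Relation.Binary.PropositionalEquality
open import Data.Integer using (+_)
open import Data.Rational using (ℚ; 0ℚ; ½; _/_; _+_; _*_; _≤_; _≥_; _<_)
open import Data.Rational.Properties hiding (_≟_)
open import Data.Rational.Solver using (module +-*-Solver)
open +-*-Solver using (solve; _:+_; _:*_; con; _:=_)

open import Algebra.Properties.CommutativeSemigroup
  (CommutativeMonoid.commutativeSemigroup +-0-commutativeMonoid) using (interchange)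
open import Algebra.Properties.CommutativeMonoid.Sum +-0-commutativeMonoid
  using (sum; sum-cong-≗; ∑-distrib-+; ∑-comm)

sumFin≡sum : ∀ k (f : Fin k → ℚ) → sumFin k f ≡ sum f
sumFin≡sum zero    f = refl
sumFin≡sum (suc k) f = cong (_+_ (f zero)) (sumFin≡sum k (λ e → f (suc e)))

sumFin-cong : ∀ k {f g : Fin k → ℚ} → (∀ e → f e ≡ g e) → sumFin k f ≡ sumFin k g
sumFin-cong zero    f≗g = refl
sumFin-cong (suc k) f≗g = cong₂ _+_ (f≗g zero) (sumFin-cong k (λ e → f≗g (suc e)))

sumFin-mono : ∀ k {f g : Fin k → ℚ} → (∀ e → f e ≤ g e) → sumFin k f ≤ sumFin k g
sumFin-mono zero    f≤g = ≤-refl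
sumFin-mono (suc k) f≤g = +-mono-≤ (f≤g zero) (sumFin-mono k (λ e → f≤g (suc e)))

sumFin-zero : ∀ k {f : Fin k → ℚ} → (∀ e → f e ≡ 0ℚ) → sumFin k f ≡ 0ℚ
sumFin-zero zero    f≗0 = refl
sumFin-zero (suc k) f≗0 = cong₂ _+_ (f≗0 zero) (sumFin-zero k (λ e → f≗0 (suc e)))

sumFin-nonneg : ∀ k {f : Fin k → ℚ} → (∀ e → 0ℚ ≤ f e) → 0ℚ ≤ sumFin k f
sumFin-nonneg zero    0≤f = ≤-refl
sumFin-nonneg (suc k) 0≤f = +-mono-≤ (0≤f zero) (sumFin-nonneg k (λ e → 0≤f (suc e)))

sumFin-distrib-+ : ∀ k (f g : Fin k → ℚ) →
  sumFin k (λ e → f e + g e) ≡ sumFin k f + sumFin k g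
sumFin-distrib-+ k f g = begin
  sumFin k (λ e → f e + g e) ≡⟨ sumFin≡sum k _ ⟩
  sum (λ e → f e + g e)      ≡⟨ ∑-distrib-+ f g ⟩
  sum f + sum g              ≡⟨ sym (cong₂ _+_ (sumFin≡sum k f) (sumFin≡sum k g)) ⟩
  sumFin k f + sumFin k g    ∎
  where open ≡-Reasoning

sumFin-comm : ∀ m k (F : Fin m → Fin k → ℚ) →
  sumFin m (λ j → sumFin k (F j)) ≡ sumFin k (λ e → sumFin m (λ j → F j e))
sumFin-comm m k F = begin
  sumFin m (λ j → sumFin k (F j))     ≡⟨ sumFin≡sum m _ ⟩
  sum (λ j → sumFin k (F j))          ≡⟨ sum-cong-≗ (λ j → sumFin≡sum k (F j)) ⟩
  sum (λ j → sum (F j))               ≡⟨ ∑-comm F ⟩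
  sum (λ e → sum (λ j → F j e))       ≡⟨ sym (sum-cong-≗ (λ e → sumFin≡sum m (λ j → F j e))) ⟩
  sum (λ e → sumFin m (λ j → F j e))  ≡⟨ sym (sumFin≡sum k _) ⟩
  sumFin k (λ e → sumFin m (λ j → F j e)) ∎
  where open ≡-Reasoning

term≤sumFin : ∀ k {f : Fin k → ℚ} → (∀ e → 0ℚ ≤ f e) → ∀ x → f x ≤ sumFin k f
term≤sumFin (suc k) {f} 0≤f zero = begin
  f zero               ≡⟨ sym (+-identityʳ (f zero)) ⟩
  f zero + 0ℚ          ≤⟨ +-monoʳ-≤ (f zero) (sumFin-nonneg k (λ e → 0≤f (suc e))) ⟩
  sumFin (suc k) f     ∎
  where open ≤-Reasoning
term≤sumFin (suc k) {f} 0≤f (suc x) = begin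
  f (suc x)            ≡⟨ sym (+-identityˡ (f (suc x))) ⟩
  0ℚ + f (suc x)       ≤⟨ +-mono-≤ (0≤f zero) (term≤sumFin k (λ e → 0≤f (suc e)) x) ⟩
  sumFin (suc k) f     ∎
  where open ≤-Reasoning

sumFin-single : ∀ k {f : Fin k → ℚ} x → (∀ e → e ≢ x → f e ≡ 0ℚ) → sumFin k f ≡ f x
sumFin-single (suc k) {f} zero f≗0 =
  trans (cong (_+_ (f zero)) (sumFin-zero k (λ e → f≗0 (suc e) λ ()))) (+-identityʳ _)
sumFin-single (suc k) {f} (suc x) f≗0 =
  trans (cong₂ _+_ (f≗0 zero λ ())
               (sumFin-single k {λ e → f (suc e)} x (λ e e≢x → f≗0 (suc e) (e≢x ∘ suc-injective))))
        (+-identityˡ _)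

isYes-true : ∀ {p} {A : Set p} (a? : Dec A) → A → ⌊ a? ⌋ ≡ true
isYes-true a? a = trans (isYes≗does a?) (dec-true a? a)

sumFin-indicator : ∀ m (x : Fin m) v → sumFin m (λ j → if ⌊ x ≟ j ⌋ then v else 0ℚ) ≡ v
sumFin-indicator m x v = begin
  sumFin m (λ j → if ⌊ x ≟ j ⌋ then v else 0ℚ) ≡⟨ sumFin-single m x off-x ⟩
  (if ⌊ x ≟ x ⌋ then v else 0ℚ)                ≡⟨ cong (if_then v else 0ℚ) (isYes-true (x ≟ x) refl) ⟩
  v                                            ∎
  where
  open ≡-Reasoning
  off-x : ∀ j → j ≢ x → (if ⌊ x ≟ j ⌋ then v else 0ℚ) ≡ 0ℚ
  off-x j j≢x with x ≟ j
  ... | yes x≡j = contradiction (sym x≡j) j≢x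
  ... | no  _   = refl

sumFin-fibres : ∀ m k (f : Fin k → Fin m) (h : Fin k → ℚ) →
  sumFin m (λ j → sumFin k (λ e → if ⌊ f e ≟ j ⌋ then h e else 0ℚ)) ≡ sumFin k h
sumFin-fibres m k f h =
  trans (sumFin-comm m k _) (sumFin-cong k (λ e → sumFin-indicator m (f e) (h e)))

p≤p+q : ∀ {p q} → 0ℚ ≤ q → p ≤ p + q
p≤p+q {p} 0≤q = ≤-trans (≤-reflexive (sym (+-identityʳ p))) (+-monoʳ-≤ p 0≤q)

if-nonneg : ∀ b {x} → 0ℚ ≤ x → 0ℚ ≤ (if b then x else 0ℚ)
if-nonneg true  0≤x = 0≤x
if-nonneg false 0≤x = ≤-refl

if-≤ : ∀ b {x c} → (b ≡ true → x ≤ c) → 0ℚ ≤ c → (if b then x else 0ℚ) ≤ c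
if-≤ true  x≤c 0≤c = x≤c refl
if-≤ false x≤c 0≤c = 0≤c

if-∧ : ∀ a b (x : ℚ) → (if a ∧ b then x else 0ℚ) ≡ (if b then (if a then x else 0ℚ) else 0ℚ)
if-∧ true  b     x = refl
if-∧ false true  x = refl
if-∧ false false x = refl

sumFin-≤-atMostOne : ∀ k {P : Fin k → Set} (P? : Decidable P) {f : Fin k → ℚ} {c} →
  0ℚ ≤ c → (∀ e → ¬ P e → f e ≡ 0ℚ) → (∀ e → P e → f e ≤ c) →
  (∀ e e′ → P e → P e′ → e ≡ e′) → sumFin k f ≤ c
sumFin-≤-atMostOne k {P} P? {f} {c} 0≤c f≗0 f≤c unique with any? P?
... | yes (x , Px) = begin
  sumFin k f ≡⟨ sumFin-single k x (λ e e≢x → f≗0 e (λ Pe → e≢x (unique e x Pe Px))) ⟩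
  f x        ≤⟨ f≤c x Px ⟩
  c          ∎
  where open ≤-Reasoning
... | no ¬P = begin
  sumFin k f ≡⟨ sumFin-zero k (λ e → f≗0 e (λ Pe → ¬P (e , Pe))) ⟩
  0ℚ         ≤⟨ 0≤c ⟩
  c          ∎
  where open ≤-Reasoning

sumFin-fibre-≤ : ∀ k {m} (key : Fin k → Fin m) (s : Fin k → Bool) (part : Fin k → ℚ) (x : Fin m) {c} →
  0ℚ ≤ c → (∀ e → s e ≡ false → part e ≡ 0ℚ) → (∀ e → s e ≡ true → key e ≡ x → part e ≤ c) →
  (∀ {e e′} → s e ≡ true → s e′ ≡ true → key e ≡ key e′ → e ≡ e′) →
  sumFin k (λ e → if ⌊ key e ≟ x ⌋ then part e else 0ℚ) ≤ c
sumFin-fibre-≤ k key s part x {c} 0≤c part-off part≤c injective =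
  sumFin-≤-atMostOne k (λ e → (s e ≟ᵇ true) ×-dec (key e ≟ x)) 0≤c vanish bound
    (λ { e e′ (se , ex) (se′ , e′x) → injective se se′ (trans ex (sym e′x)) })
  where
  vanish : ∀ e → ¬ (s e ≡ true × key e ≡ x) → (if ⌊ key e ≟ x ⌋ then part e else 0ℚ) ≡ 0ℚ
  vanish e off with key e ≟ x
  ... | no  _  = refl
  ... | yes ex = part-off e (¬-not (λ se → off (se , ex)))
  bound : ∀ e → s e ≡ true × key e ≡ x → (if ⌊ key e ≟ x ⌋ then part e else 0ℚ) ≤ c
  bound e (se , ex) = if-≤ ⌊ key e ≟ x ⌋ (λ _ → part≤c e se ex) 0≤c

jobLoad : ∀ {n} (r : Round n) → (Fin (k r) → Bool) → Fin (m r) → ℚ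
jobLoad r s j = sumFin (k r) (λ e → if ⌊ job r e ≟ j ⌋ then (if s e then w r e else 0ℚ) else 0ℚ)

module _ {n} {r : Round n} where

  roundLoad-nonneg : WellFormedRound r → ∀ s i → 0ℚ ≤ roundLoad r s i
  roundLoad-nonneg (0≤w , _) s i =
    sumFin-nonneg (k r) (λ e → if-nonneg (s e ∧ ⌊ srv r e ≟ i ⌋) (0≤w e))

  edge≤roundLoad : WellFormedRound r → ∀ s {e} → s e ≡ true → w r e ≤ roundLoad r s (srv r e)
  edge≤roundLoad (0≤w , _) s {e} se = begin
    w r e
      ≡⟨ cong₂ (λ a b → if a ∧ b then w r e else 0ℚ) se (isYes-true (srv r e ≟ srv r e) refl) ⟨
    (if s e ∧ ⌊ srv r e ≟ srv r e ⌋ then w r e else 0ℚ)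
      ≤⟨ term≤sumFin (k r) (λ e′ → if-nonneg (s e′ ∧ _) (0≤w e′)) e ⟩
    roundLoad r s (srv r e) ∎
    where open ≤-Reasoning

  sumFin-roundLoad : ∀ s → sumFin n (roundLoad r s) ≡ roundWeight r s
  sumFin-roundLoad s =
    trans (sumFin-cong n (λ i → sumFin-cong (k r) (λ e → if-∧ (s e) ⌊ srv r e ≟ i ⌋ (w r e))))
          (sumFin-fibres n (k r) (srv r) _)

  sumFin-jobLoad : ∀ s → sumFin (m r) (jobLoad r s) ≡ roundWeight r s
  sumFin-jobLoad s = sumFin-fibres (m r) (k r) (job r) _

  jobLoad-nonneg : WellFormedRound r → ∀ s j → 0ℚ ≤ jobLoad r s j
  jobLoad-nonneg (0≤w , _) s j =
    sumFin-nonneg (k r) (λ e → if-nonneg ⌊ job r e ≟ j ⌋ (if-nonneg (s e) (0≤w e)))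

  edge≤jobLoad : WellFormedRound r → ∀ s {e} → s e ≡ true → w r e ≤ jobLoad r s (job r e)
  edge≤jobLoad (0≤w , _) s {e} se = begin
    w r e
      ≡⟨ cong₂ (λ a b → if b then (if a then w r e else 0ℚ) else 0ℚ) se
               (isYes-true (job r e ≟ job r e) refl) ⟨
    (if ⌊ job r e ≟ job r e ⌋ then (if s e then w r e else 0ℚ) else 0ℚ)
      ≤⟨ term≤sumFin (k r) (λ e′ → if-nonneg ⌊ job r e′ ≟ job r e ⌋ (if-nonneg (s e′) (0≤w e′))) e ⟩
    jobLoad r s (job r e) ∎
    where open ≤-Reasoning

  module _ {s : Fin (k r) → Bool} (matching : IsMatching r s) {e e′ : Fin (k r)}
           (se : s e ≡ true) (se′ : s e′ ≡ true) where

    matching-srv-injective : srv r e ≡ srv r e′ → e ≡ e′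
    matching-srv-injective same with e ≟ e′
    ... | yes e≡e′ = e≡e′
    ... | no  e≢e′ = contradiction same (proj₁ (matching e e′ se se′ e≢e′))

    matching-job-injective : job r e ≡ job r e′ → e ≡ e′
    matching-job-injective same with e ≟ e′
    ... | yes e≡e′ = e≡e′
    ... | no  e≢e′ = contradiction same (proj₂ (matching e e′ se se′ e≢e′))

load-nonneg : ∀ {n} {rs : List (Round n)} → WellFormed rs → (F : Sel rs) → ∀ i → 0ℚ ≤ load F i
load-nonneg _          []      i = ≤-refl
load-nonneg (wf , wfs) (s ∷ F) i = +-mono-≤ (roundLoad-nonneg wf s i) (load-nonneg wfs F i)

sumFin-load : ∀ {n} {rs : List (Round n)} (F : Sel rs) → sumFin n (load F) ≡ weight F
sumFin-load {n} []      = sumFin-zero n (λ _ → refl)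
sumFin-load {n} (_∷_ {r} s F) =
  trans (sumFin-distrib-+ n _ _) (cong₂ _+_ (sumFin-roundLoad {r = r} s) (sumFin-load F))

∧-not-false⇒T : ∀ {a b} → a ≡ true → a ∧ not b ≡ false → T b
∧-not-false⇒T {b = true} refl _ = _

not-∨-true⇒ : ∀ {a b} → a ≡ true → not a ∨ b ≡ true → b ≡ true
not-∨-true⇒ refl b≡true = b≡true

Blocks : ∀ {n} (r : Round n) → Fin (k r) → Fin (k r) → Set
Blocks r g e = (srv r g ≡ srv r e ⊎ job r g ≡ job r e) × w r e ≤ w r g

module _ {n} (r : Round n) (S : Fin n → Bool) where

  greedyScan-keeps : ∀ ch es {g} → g ∈ ch → g ∈ greedyScan r S ch es
  greedyScan-keeps ch []       g∈ch = g∈ch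
  greedyScan-keeps ch (x ∷ es) g∈ch with S (srv r x) ∧ not (any (conflict r x) ch)
  ... | true  = greedyScan-keeps (x ∷ ch) es (there g∈ch)
  ... | false = greedyScan-keeps ch es g∈ch

  rejected-conflicts : ∀ {x} ch → S (srv r x) ≡ true →
    S (srv r x) ∧ not (any (conflict r x) ch) ≡ false →
    ∃ λ g → g ∈ ch × (srv r g ≡ srv r x ⊎ job r g ≡ job r x)
  rejected-conflicts {x} ch active rejected
    with g , g∈ch , clash ← find (any⁻ (conflict r x) ch (∧-not-false⇒T active rejected))
    with Equivalence.to (T-∨ {⌊ srv r x ≟ srv r g ⌋}) clash
  ... | inj₁ same-srv = g , g∈ch , inj₁ (sym (toWitness {a? = srv r x ≟ srv r g} same-srv))
  ... | inj₂ same-job = g , g∈ch , inj₂ (sym (toWitness {a? = job r x ≟ job r g} same-job))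

  greedyScan-blocks : ∀ ch es → AllPairs (λ a b → w r b ≤ w r a) es →
    All (λ g → All (λ x → w r x ≤ w r g) es) ch →
    ∀ {e} → e ∈ es → S (srv r e) ≡ true → ∃ λ g → g ∈ greedyScan r S ch es × Blocks r g e
  greedyScan-blocks ch (x ∷ es) (x≥es ∷ sorted) ch≥ e∈ active
    with S (srv r x) ∧ not (any (conflict r x) ch) in taken | e∈
  ... | true  | here refl = x , greedyScan-keeps (x ∷ ch) es (here refl) , inj₁ refl , ≤-refl
  ... | true  | there e∈es =
    greedyScan-blocks (x ∷ ch) es sorted (x≥es ∷ All.map All.tail ch≥) e∈es active
  ... | false | there e∈es = greedyScan-blocks ch es sorted (All.map All.tail ch≥) e∈es active
  ... | false | here refl with g , g∈ch , clash ← rejected-conflicts ch active taken =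
    g , greedyScan-keeps ch es g∈ch , clash , All.head (All.lookup ch≥ g∈ch)

  greedy-blocks : ∀ {o} → ValidOrder r o → ∀ {e} → S (srv r e) ≡ true →
    ∃ λ g → greedy r S o g ≡ true × Blocks r g e
  greedy-blocks {o} (o↭edges , sorted) {e} active
    with g , g∈ , blocks ←
      greedyScan-blocks [] o sorted All.[] (∈-resp-↭ (↭-sym o↭edges) (∈-allFin e)) active =
    g , Equivalence.to T-≡ (any⁺ _ (Any.map (λ { refl → fromWitness refl }) g∈)) , blocks

module Charging {n} (r : Round n) (S : Fin n → Bool) (o : List (Fin (k r))) (s : Fin (k r) → Bool) where

  M : Fin (k r) → Bool
  M = greedy r S o

  heavierAtServer? : ∀ e → Dec (∃ λ g → M g ≡ true × srv r g ≡ srv r e × w r e ≤ w r g)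
  heavierAtServer? e = any? (λ g → (M g ≟ᵇ true) ×-dec ((srv r g ≟ srv r e) ×-dec (w r e ≤? w r g)))

  toServer : Fin (k r) → Bool
  toServer e = not (S (srv r e)) ∨ ⌊ heavierAtServer? e ⌋

  serverPart : Fin (k r) → ℚ
  serverPart e = if s e ∧ toServer e then w r e else 0ℚ

  jobPart : Fin (k r) → ℚ
  jobPart e = if s e ∧ not (toServer e) then w r e else 0ℚ

  serverCharge : Fin n → ℚ
  serverCharge i = sumFin (k r) (λ e → if ⌊ srv r e ≟ i ⌋ then serverPart e else 0ℚ)

  jobCharge : ℚ
  jobCharge = sumFin (k r) jobPart

  roundWeight-split : roundWeight r s ≡ sumFin n serverCharge + jobCharge
  roundWeight-split = begin
    roundWeight r s
      ≡⟨ sumFin-cong (k r) parts ⟩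
    sumFin (k r) (λ e → serverPart e + jobPart e)
      ≡⟨ sumFin-distrib-+ (k r) serverPart jobPart ⟩
    sumFin (k r) serverPart + jobCharge
      ≡⟨ cong (_+ jobCharge) (sumFin-fibres n (k r) (srv r) serverPart) ⟨
    sumFin n serverCharge + jobCharge ∎
    where
    open ≡-Reasoning
    parts : ∀ e → (if s e then w r e else 0ℚ) ≡ serverPart e + jobPart e
    parts e with s e | toServer e
    ... | true  | true  = sym (+-identityʳ _)
    ... | true  | false = sym (+-identityˡ _)
    ... | false | _     = refl

  module _ (wf : WellFormedRound r) where

    serverCharge≤roundLoad : ∀ i → serverCharge i ≤ roundLoad r s i
    serverCharge≤roundLoad i = sumFin-mono (k r) part≤
      where
      part≤ : ∀ e → (if ⌊ srv r e ≟ i ⌋ then serverPart e else 0ℚ)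
                    ≤ (if s e ∧ ⌊ srv r e ≟ i ⌋ then w r e else 0ℚ)
      part≤ e with ⌊ srv r e ≟ i ⌋ | s e | toServer e
      ... | true  | true  | true  = ≤-refl
      ... | true  | true  | false = proj₁ wf e
      ... | true  | false | _     = ≤-refl
      ... | false | a     | _     = if-nonneg (a ∧ false) (proj₁ wf e)

    serverCharged-active : ∀ {e} → s e ∧ toServer e ≡ true → S (srv r e) ≡ true →
      ∃ λ g → M g ≡ true × srv r g ≡ srv r e × w r e ≤ w r g
    serverCharged-active {e} charged active =
      toWitness {a? = heavierAtServer? e}
        (Equivalence.from T-≡ (not-∨-true⇒ active (∧-conicalʳ (s e) _ charged)))

    module _ (valid : ValidOrder r o) where

      jobCharged : ∀ {e} → not (toServer e) ≡ true →
        ∃ λ g → M g ≡ true × job r g ≡ job r e × w r e ≤ w r g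
      jobCharged {e} unblocked with S (srv r e) in active | heavierAtServer? e
      jobCharged {e} ()        | false | _
      jobCharged {e} ()        | true  | yes _
      jobCharged {e} unblocked | true  | no ¬heavier with greedy-blocks r S valid active
      ... | g , Mg , inj₁ same-srv , e≤g = contradiction (g , Mg , same-srv , e≤g) ¬heavier
      ... | g , Mg , inj₂ same-job , e≤g = g , Mg , same-job , e≤g

      module _ (matching : IsMatching r s) where

        serverCharge≤greedyLoad : ∀ i → S i ≡ true → serverCharge i ≤ roundLoad r M i
        serverCharge≤greedyLoad i active =
          sumFin-fibre-≤ (k r) (srv r) s serverPart i (roundLoad-nonneg wf M i) off bound
            (matching-srv-injective {r = r} matching)
          where
          off : ∀ e → s e ≡ false → serverPart e ≡ 0ℚ
          off e se rewrite se = refl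
          bound : ∀ e → s e ≡ true → srv r e ≡ i → serverPart e ≤ roundLoad r M i
          bound e _ at-i = subst (λ x → serverPart e ≤ roundLoad r M x) at-i
            (if-≤ (s e ∧ toServer e) charge (roundLoad-nonneg wf M (srv r e)))
            where
            charge : s e ∧ toServer e ≡ true → w r e ≤ roundLoad r M (srv r e)
            charge charged
              with g , Mg , same-srv , e≤g ←
                serverCharged-active charged (subst (λ x → S x ≡ true) (sym at-i) active) =
              ≤-trans e≤g (subst (λ x → w r g ≤ roundLoad r M x) same-srv (edge≤roundLoad wf M Mg))

        jobCharge≤greedyWeight : jobCharge ≤ roundWeight r M
        jobCharge≤greedyWeight = begin
          jobCharge
            ≡⟨ sumFin-fibres (m r) (k r) (job r) jobPart ⟨
          sumFin (m r) (λ j → sumFin (k r) (λ e → if ⌊ job r e ≟ j ⌋ then jobPart e else 0ℚ))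
            ≤⟨ sumFin-mono (m r) perJob ⟩
          sumFin (m r) (jobLoad r M)
            ≡⟨ sumFin-jobLoad {r = r} M ⟩
          roundWeight r M ∎
          where
          open ≤-Reasoning
          off : ∀ e → s e ≡ false → jobPart e ≡ 0ℚ
          off e se rewrite se = refl
          bound : ∀ j e → s e ≡ true → job r e ≡ j → jobPart e ≤ jobLoad r M j
          bound j e _ at-j = subst (λ x → jobPart e ≤ jobLoad r M x) at-j
            (if-≤ (s e ∧ not (toServer e)) charge (jobLoad-nonneg wf M (job r e)))
            where
            charge : s e ∧ not (toServer e) ≡ true → w r e ≤ jobLoad r M (job r e)
            charge charged with g , Mg , same-job , e≤g ← jobCharged (∧-conicalʳ (s e) _ charged) =
              ≤-trans e≤g (subst (λ x → w r g ≤ jobLoad r M x) same-job (edge≤jobLoad wf M Mg))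
          perJob : ∀ j → sumFin (k r) (λ e → if ⌊ job r e ≟ j ⌋ then jobPart e else 0ℚ) ≤ jobLoad r M j
          perJob j = sumFin-fibre-≤ (k r) (job r) s jobPart j (jobLoad-nonneg wf M j) off (bound j)
            (matching-job-injective {r = r} matching)

deactivation-cause : ∀ {a b p} {P : Set p} {P? : Dec P} → a ≡ true → a ∧ not (b ∧ ⌊ P? ⌋) ≡ false → P
deactivation-cause {true} {true}  {P? = yes p} _ _  = p
deactivation-cause {true} {true}  {P? = no _}  _ ()
deactivation-cause {true} {false}              _ ()

module OnlineGreedyRun {n} (C : Fin n → ℚ) where

  nextActive : (Fin n → Bool) → (Fin n → ℚ) → (r : Round n) → List (Fin (k r)) → Fin n → Bool
  nextActive S L r o i =
    S i ∧ not (matched r (greedy r S o) i ∧ ⌊ ½ * C i <? (L i + roundLoad r (greedy r S o) i) ⌋)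

  nextLoad : (Fin n → Bool) → (Fin n → ℚ) → (r : Round n) → List (Fin (k r)) → Fin n → ℚ
  nextLoad S L r o i = L i + roundLoad r (greedy r S o) i

  totalServerCharge : (S : Fin n → Bool) (L : Fin n → ℚ) {rs : List (Round n)} →
    Orders rs → Sel rs → Fin n → ℚ
  totalServerCharge S L []             []      i = 0ℚ
  totalServerCharge S L (_∷_ {r} o os) (s ∷ F) i =
    Charging.serverCharge r S o s i + totalServerCharge (nextActive S L r o) (nextLoad S L r o) os F i

  totalJobCharge : (S : Fin n → Bool) (L : Fin n → ℚ) {rs : List (Round n)} → Orders rs → Sel rs → ℚ
  totalJobCharge S L []             []      = 0ℚ
  totalJobCharge S L (_∷_ {r} o os) (s ∷ F) =
    Charging.jobCharge r S o s + totalJobCharge (nextActive S L r o) (nextLoad S L r o) os F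

  weight-split : ∀ S L {rs} (os : Orders rs) (F : Sel rs) →
    weight F ≡ sumFin n (totalServerCharge S L os F) + totalJobCharge S L os F
  weight-split S L []             []      =
    sym (trans (+-identityʳ _) (sumFin-zero n (λ _ → refl)))
  weight-split S L (_∷_ {r} o os) (s ∷ F) = begin
    roundWeight r s + weight F
      ≡⟨ cong₂ _+_ (Charging.roundWeight-split r S o s) (weight-split S′ L′ os F) ⟩
    (sumFin n P + Z) + (sumFin n Pᵀ + Zᵀ)
      ≡⟨ interchange (sumFin n P) Z (sumFin n Pᵀ) Zᵀ ⟩
    (sumFin n P + sumFin n Pᵀ) + (Z + Zᵀ)
      ≡⟨ cong (_+ (Z + Zᵀ)) (sumFin-distrib-+ n P Pᵀ) ⟨
    sumFin n (λ i → P i + Pᵀ i) + (Z + Zᵀ) ∎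
    where
    open ≡-Reasoning
    S′ : Fin n → Bool
    S′ = nextActive S L r o
    L′ P Pᵀ : Fin n → ℚ
    L′ = nextLoad S L r o
    P  = Charging.serverCharge r S o s
    Pᵀ = totalServerCharge S′ L′ os F
    Z Zᵀ : ℚ
    Z  = Charging.jobCharge r S o s
    Zᵀ = totalJobCharge S′ L′ os F

  totalJobCharge≤weight : ∀ S L {rs} (os : Orders rs) (F : Sel rs) →
    WellFormed rs → ValidOrders os → AllMatching F → totalJobCharge S L os F ≤ weight (runOG C S L os)
  totalJobCharge≤weight S L []             []      _          _              _                = ≤-refl
  totalJobCharge≤weight S L (_∷_ {r} o os) (s ∷ F) (wf , wfs) (valid , valids) (matching , matchings) =
    +-mono-≤ (Charging.jobCharge≤greedyWeight r S o s wf valid matching)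
             (totalJobCharge≤weight (nextActive S L r o) (nextLoad S L r o) os F wfs valids matchings)

  totalServerCharge≤load : ∀ S L {rs} (os : Orders rs) (F : Sel rs) → WellFormed rs →
    ∀ i → totalServerCharge S L os F i ≤ load F i
  totalServerCharge≤load S L []             []      _          i = ≤-refl
  totalServerCharge≤load S L (_∷_ {r} o os) (s ∷ F) (wf , wfs) i =
    +-mono-≤ (Charging.serverCharge≤roundLoad r S o s wf i)
             (totalServerCharge≤load (nextActive S L r o) (nextLoad S L r o) os F wfs i)

  totalServerCharge≤load-or-saturated : ∀ S L {rs} (os : Orders rs) (F : Sel rs) →
    WellFormed rs → ValidOrders os → AllMatching F → ∀ i → S i ≡ true →
    totalServerCharge S L os F i ≤ load (runOG C S L os) i ⊎ ½ * C i < L i + load (runOG C S L os) i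
  totalServerCharge≤load-or-saturated S L [] [] _ _ _ i active = inj₁ ≤-refl
  totalServerCharge≤load-or-saturated S L (_∷_ {r} o os) (s ∷ F) (wf , wfs) (valid , valids)
    (matching , matchings) i active with nextActive S L r o i in stays
  ... | true with totalServerCharge≤load-or-saturated (nextActive S L r o) (nextLoad S L r o) os F
                    wfs valids matchings i stays
  ...   | inj₁ paid      =
    inj₁ (+-mono-≤ (Charging.serverCharge≤greedyLoad r S o s wf valid matching i active) paid)
  ...   | inj₂ saturated = inj₂ (<-≤-trans saturated (≤-reflexive (+-assoc (L i) _ _)))
  totalServerCharge≤load-or-saturated S L (_∷_ {r} o os) (s ∷ F) (wf , wfs) _ _ i active | false =
    inj₂ (<-≤-trans (deactivation-cause {P? = ½ * C i <? (L i + roundLoad r M i)} active stays)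
      (+-monoʳ-≤ (L i) (p≤p+q (load-nonneg wfs (runOG C _ _ os) i))))
    where
    M : Fin (k r) → Bool
    M = greedy r S o

open OnlineGreedyRun

one-third-of-thrice : ∀ a → (+ 1 / 3) * ((a + a) + a) ≡ a
one-third-of-thrice = solve 1 (λ a → con (+ 1 / 3) :* ((a :+ a) :+ a) := a) refl

halves : ∀ c → ½ * c + ½ * c ≡ c
halves = solve 1 (λ c → con ½ :* c :+ con ½ :* c := c) refl

module _ {n} (C : Fin n → ℚ) {rs : List (Round n)} (os : Orders rs) (F : Sel rs)
         (wf : WellFormed rs) (valids : ValidOrders os) where

  serverCharge≤twice-greedyLoad : Feasible C F → ∀ i →
    totalServerCharge C (λ _ → true) (λ _ → 0ℚ) os F i
      ≤ load (onlineGreedy C os) i + load (onlineGreedy C os) i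
  serverCharge≤twice-greedyLoad (matchings , fits) i
    with totalServerCharge≤load-or-saturated C _ _ os F wf valids matchings i refl
  ... | inj₁ paid      = ≤-trans paid (p≤p+q (load-nonneg wf (onlineGreedy C os) i))
  ... | inj₂ saturated = begin
    totalServerCharge C _ _ os F i ≤⟨ totalServerCharge≤load C _ _ os F wf i ⟩
    load F i                       ≤⟨ fits i ⟩
    C i                            ≡⟨ halves (C i) ⟨
    ½ * C i + ½ * C i              ≤⟨ +-mono-≤ half≤A half≤A ⟩
    load A i + load A i            ∎
    where
    open ≤-Reasoning
    A : Sel rs
    A = onlineGreedy C os
    half≤A : ½ * C i ≤ load A i
    half≤A = <⇒≤ (<-≤-trans saturated (≤-reflexive (+-identityˡ (load A i))))

  feasible-weight≤thrice-greedy : Feasible C F →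
    weight F ≤ (weight (onlineGreedy C os) + weight (onlineGreedy C os)) + weight (onlineGreedy C os)
  feasible-weight≤thrice-greedy feasible = begin
    weight F
      ≡⟨ weight-split C _ _ os F ⟩
    sumFin n P + totalJobCharge C _ _ os F
      ≤⟨ +-mono-≤ (sumFin-mono n (serverCharge≤twice-greedyLoad feasible))
                  (totalJobCharge≤weight C _ _ os F wf valids (proj₁ feasible)) ⟩
    sumFin n (λ i → load A i + load A i) + wA
      ≡⟨ cong (_+ wA) (sumFin-distrib-+ n (load A) (load A)) ⟩
    (sumFin n (load A) + sumFin n (load A)) + wA
      ≡⟨ cong (λ x → (x + x) + wA) (sumFin-load A) ⟩
    (wA + wA) + wA ∎
    where
    open ≤-Reasoning
    A : Sel rs
    A = onlineGreedy C os
    wA : ℚ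
    wA = weight A
    P : Fin n → ℚ
    P = totalServerCharge C (λ _ → true) (λ _ → 0ℚ) os F

-- Positivity of C and HalfCap only ensure that ONLINEGREEDY's output is feasible; the bound
-- does not use them.
theorem1 : ∀ {n : ℕ} (C : Fin n → ℚ) (rs : List (Round n)) (os : Orders rs) →
    (∀ i → 0ℚ < C i) → WellFormed rs → HalfCap C rs → ValidOrders os →
    (F : Sel rs) → Feasible C F →
    weight (onlineGreedy C os) ≥ (+ 1 / 3) * weight F
theorem1 C rs os _ wf _ valids F feasible = begin
  (+ 1 / 3) * weight F
    ≤⟨ *-monoˡ-≤-nonNeg (+ 1 / 3) (feasible-weight≤thrice-greedy C os F wf valids feasible) ⟩
  (+ 1 / 3) * ((wA + wA) + wA)
    ≡⟨ one-third-of-thrice wA ⟩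
  wA ∎
  where
  open ≤-Reasoning
  wA : ℚ
  wA = weight (onlineGreedy C os)
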